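{- Let $p, q \in \mathbb N_{>1}$, $m_i, n_i \in \mathbb N_{>1}$ ($i = 0,1,\ldots$) and positive rationals $a$, $a_k$ ($k=1,2,\ldots$) satisfy: (i) $(m,n)\mapsto p^mq^n$ is injective on $\mathbb N_{>1}\times\mathbb N_{>1}$; (ii) the pairs $(m_i,n_i)$ enumerate $\mathbb N_{>1}\times\mathbb N_{>1}$; (iii) $p^{m_0}q^{n_0} < p^{m_1}q^{n_1} < \cdots$; (iv) $a_{4i+1} = p^{ -m_i}q^{ -n_i}$, $a_{4i+2} = m_i p^{ -m_i}q^{ -n_i}$, $a_{4i+3} = m_in_ip^{ -m_i}q^{ -n_i}$, $a_{4i+4} = n_ip^{ -m_i}q^{ -n_i}$ for all $i \ge 0$; (v) $\sum_{k=1}^\infty a_k$ converges to $a < 1$. Then there are positive rationals $b_1, b_2, \ldots$ with $1 > b_1 > b_2 > \cdots$ such that $b = \sum_{k=1}^\infty b_k a_k$ is a positive rational number.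
   Context: $\mathbb N_{>1}$ denotes the set of natural numbers greater than $1$. -}

module Defs where

open import Data.Nat as ℕ using (ℕ; zero; suc; _^_; _≤_; NonZero)
open import Data.Nat.Properties using (m^n≢0; m*n≢0; <-≤-trans)
open import Data.Integer using (+_)
open import Data.Rational using (ℚ; 0ℚ; _+_; _-_; _<_; ∣_∣; _/_)
open import Data.Product using (∃-syntax; _×_)

2≤⇒nonZero : ∀ {p} → 2 ≤ p → NonZero p
2≤⇒nonZero {p} h = ℕ.>-nonZero (<-≤-trans (ℕ.s≤s ℕ.z≤n) h)

invPow : ∀ {p q} → 2 ≤ p → 2 ≤ q → ℕ → ℕ → ℚ
invPow {p} {q} hp hq m n =
  let instance
        _ = 2≤⇒nonZero hp
        _ = 2≤⇒nonZero hq
        _ = m^n≢0 p m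
        _ = m^n≢0 q n
        _ = m*n≢0 (p ^ m) (q ^ n)
  in (+ 1) / (p ^ m ℕ.* q ^ n)

partialSum : (ℕ → ℚ) → ℕ → ℚ
partialSum f zero = 0ℚ
partialSum f (suc N) = partialSum f N + f (suc N)

SeriesConvergesTo : (ℕ → ℚ) → ℚ → Set
SeriesConvergesTo f L =
  ∀ (ε : ℚ) → 0ℚ < ε → ∃[ N ] (∀ M → N ≤ M → ∣ partialSum f M - L ∣ < ε)

module Submission where

-- The conclusion holds for every series of positive rationals Σ aₖ whose
-- sum a is below 1.
--
-- Let Sₖ be the partial sums and Rₖ = a − Sₖ the tails, so that
-- R₀ = a and Rₖ₋₁ − Rₖ = aₖ.  Positivity of the terms makes the tails
-- strictly decreasing and strictly positive, and convergence makes them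
-- tend to 0.  Take the weights  bₖ = (Rₖ₋₁ + Rₖ)/2.  They are positive and
-- strictly decreasing with b₁ < R₀ = a < 1, and by a difference of squares
--     bₖ aₖ = (Rₖ₋₁ + Rₖ)(Rₖ₋₁ − Rₖ)/2 = (Rₖ₋₁² − Rₖ²)/2,
-- so Σ bₖ aₖ telescopes: its M-th partial sum is (a² − R_M²)/2, which
-- converges to b = a²/2 > 0 because R_M → 0.

open import Defs
open import Data.Nat as ℕ using (ℕ; suc; _^_; _≤_)
open import Data.Rational using (ℚ; 0ℚ; 1ℚ; _<_; _*_; _/_)
open import Data.Integer using (+_)
open import Data.Product using (∃; ∃-syntax; _×_)
open import Relation.Binary.PropositionalEquality using (_≡_)
import Data.Nat.Properties as ℕP
open import Data.Rational as Q using (_+_; _-_; -_; ∣_∣; ½)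
import Data.Rational.Properties as QP
open import Data.Rational.Solver using (module +-*-Solver)
open +-*-Solver using (solve; _:+_; _:-_; _:*_; :-_; con; _:=_)
open import Data.Product using (_,_; proj₁; proj₂)
open import Data.Sum using (inj₁; inj₂)
open import Relation.Binary.PropositionalEquality using (refl; sym; trans; cong; module ≡-Reasoning)

instance
  ½-positive : Q.Positive ½
  ½-positive = _

x<x+d : ∀ x {d} → 0ℚ < d → x < x + d
x<x+d x {d} 0<d = begin-strict
  x       ≡⟨ sym (QP.+-identityʳ x) ⟩
  x + 0ℚ  <⟨ QP.+-monoʳ-< x 0<d ⟩
  x + d   ∎
  where open QP.≤-Reasoning

half-pos : ∀ {x} → 0ℚ < x → 0ℚ < x * ½
half-pos {x} 0<x = begin-strict
  0ℚ      ≡⟨ sym (QP.*-zeroˡ ½) ⟩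
  0ℚ * ½  <⟨ QP.*-monoˡ-<-pos ½ 0<x ⟩
  x * ½   ∎
  where open QP.≤-Reasoning

square-pos : ∀ {x} → 0ℚ < x → 0ℚ < x * x
square-pos {x} 0<x = begin-strict
  0ℚ     ≡⟨ sym (QP.*-zeroʳ x) ⟩
  x * 0ℚ <⟨ QP.*-monoʳ-<-pos x ⦃ Q.positive 0<x ⦄ 0<x ⟩
  x * x  ∎
  where open QP.≤-Reasoning

∣x∣<ε⇒-ε<x : ∀ {x ε} → ∣ x ∣ < ε → - ε < x
∣x∣<ε⇒-ε<x {x} {ε} ∣x∣<ε with QP.∣p∣≡p∨∣p∣≡-p x
... | inj₁ ∣x∣≡x = begin-strict
  - ε    <⟨ QP.neg-antimono-< (QP.≤-<-trans (QP.0≤∣p∣ x) ∣x∣<ε) ⟩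
  - 0ℚ   ≡⟨⟩
  0ℚ     ≤⟨ QP.∣p∣≡p⇒0≤p ∣x∣≡x ⟩
  x      ∎
  where open QP.≤-Reasoning
... | inj₂ ∣x∣≡-x = begin-strict
  - ε    <⟨ QP.neg-antimono-< (QP.≤-<-trans (QP.≤-reflexive (sym ∣x∣≡-x)) ∣x∣<ε) ⟩
  - - x  ≡⟨ solve 1 (λ y → :- :- y := y) refl x ⟩
  x      ∎
  where open QP.≤-Reasoning

-- For 0 < x ≤ 1 the quantity x²/2 does not exceed x; this bounds the
-- distance x²/2 of the telescoped partial sums to their limit by the tail x.
half-square≤ : ∀ {x} → 0ℚ < x → x Q.≤ 1ℚ → x * x * ½ Q.≤ x
half-square≤ {x} 0<x x≤1 = begin
  x * x * ½    ≡⟨ QP.*-assoc x x ½ ⟩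
  x * (x * ½)  ≤⟨ QP.*-monoˡ-≤-nonNeg x ⦃ QP.pos⇒nonNeg x ⦃ Q.positive 0<x ⦄ ⦄ x/2≤1 ⟩
  x * 1ℚ       ≡⟨ QP.*-identityʳ x ⟩
  x            ∎
  where
    open QP.≤-Reasoning
    x/2≤1 : x * ½ Q.≤ 1ℚ
    x/2≤1 = QP.<⇒≤ (QP.<-≤-trans
      (QP.<-≤-trans (x<x+d (x * ½) (half-pos 0<x))
                    (QP.≤-reflexive (solve 1 (λ y → y :* con ½ :+ y :* con ½ := y) refl x)))
      x≤1)

antitone : (f : ℕ → ℚ) → (∀ k → f (suc k) Q.≤ f k) → ∀ {k M} → k ≤ M → f M Q.≤ f k
antitone f step k≤M = go (ℕP.≤⇒≤′ k≤M)
  where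
    go : ∀ {k M} → k ℕ.≤′ M → f M Q.≤ f k
    go ℕ.≤′-refl        = QP.≤-refl
    go (ℕ.≤′-step k≤′M) = QP.≤-trans (step _) (go k≤′M)

module Tails (as : ℕ → ℚ) (a : ℚ)
  (as-pos : ∀ k → 1 ≤ k → 0ℚ < as k) (conv : SeriesConvergesTo as a) where

  S : ℕ → ℚ
  S = partialSum as

  R : ℕ → ℚ
  R k = a - S k

  R-zero : R 0 ≡ a
  R-zero = solve 1 (λ x → x :- con 0ℚ := x) refl a

  R-step : ∀ k → R (suc k) + as (suc k) ≡ R k
  R-step k = solve 3 (λ x s t → (x :- (s :+ t)) :+ t := x :- s) refl a (S k) (as (suc k))

  R-decreasing : ∀ k → R (suc k) < R k
  R-decreasing k = QP.<-≤-trans (x<x+d (R (suc k)) (as-pos (suc k) (ℕ.s≤s ℕ.z≤n)))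
                                (QP.≤-reflexive (R-step k))

  R-antitone : ∀ {k M} → k ≤ M → R M Q.≤ R k
  R-antitone = antitone R (λ k → QP.<⇒≤ (R-decreasing k))

  ∣S-a∣≡∣R∣ : ∀ M → ∣ S M - a ∣ ≡ ∣ R M ∣
  ∣S-a∣≡∣R∣ M = trans (cong ∣_∣ (solve 2 (λ x s → s :- x := :- (x :- s)) refl a (S M)))
                      (QP.∣-p∣≡∣p∣ (R M))

  -- Every tail is positive: with ε = aₖ₊₁, a late tail R_M satisfies
  -- −ε < R_M ≤ Rₖ₊₁ = Rₖ − ε.
  R-pos : ∀ k → 0ℚ < R k
  R-pos k = begin-strict
    0ℚ                   ≡⟨ sym (QP.+-inverseˡ ε) ⟩
    - ε + ε              <⟨ QP.+-monoˡ-< ε (∣x∣<ε⇒-ε<x R-late-small) ⟩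
    R M + ε              ≤⟨ QP.+-monoˡ-≤ ε (R-antitone (ℕP.m≤n+m (suc k) N)) ⟩
    R (suc k) + ε        ≡⟨ R-step k ⟩
    R k                  ∎
    where
      open QP.≤-Reasoning
      ε = as (suc k)
      eventually-close = conv ε (as-pos (suc k) (ℕ.s≤s ℕ.z≤n))
      N = proj₁ eventually-close
      M = N ℕ.+ suc k
      R-late-small : ∣ R M ∣ < ε
      R-late-small = QP.≤-<-trans (QP.≤-reflexive (sym (∣S-a∣≡∣R∣ M)))
                                  (proj₂ eventually-close M (ℕP.m≤m+n N (suc k)))

  R-small : ∀ ε → 0ℚ < ε → ∃[ N ] (∀ M → N ≤ M → R M < ε)
  R-small ε 0<ε = N , R-late-small
    where
      N = proj₁ (conv ε 0<ε)
      R-late-small : ∀ M → N ≤ M → R M < ε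
      R-late-small M N≤M = begin-strict
        R M            ≡⟨ sym (QP.0≤p⇒∣p∣≡p (QP.<⇒≤ (R-pos M))) ⟩
        ∣ R M ∣        ≡⟨ sym (∣S-a∣≡∣R∣ M) ⟩
        ∣ S M - a ∣    <⟨ proj₂ (conv ε 0<ε) M N≤M ⟩
        ε              ∎
        where open QP.≤-Reasoning

  R≤a : ∀ M → R M Q.≤ a
  R≤a M = QP.≤-trans (R-antitone {0} {M} ℕ.z≤n) (QP.≤-reflexive R-zero)

module Weights (as : ℕ → ℚ) (a : ℚ)
  (as-pos : ∀ k → 1 ≤ k → 0ℚ < as k) (conv : SeriesConvergesTo as a) where

  open Tails as a as-pos conv

  b : ℕ → ℚ
  b k = (R (k ℕ.∸ 1) + R k) * ½

  b-pos : ∀ k → 1 ≤ k → 0ℚ < b k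
  b-pos (suc k) _ = half-pos (QP.<-trans (R-pos k) (x<x+d (R k) (R-pos (suc k))))

  b-decreasing : ∀ k → 1 ≤ k → b (suc k) < b k
  b-decreasing (suc k) _ = QP.*-monoˡ-<-pos ½ (QP.+-mono-< (R-decreasing k) (R-decreasing (suc k)))

  -- b₁ is the average of R₀ = a and R₁ < a.
  b-first : a < 1ℚ → b 1 < 1ℚ
  b-first a<1 = begin-strict
    (R 0 + R 1) * ½      <⟨ QP.*-monoˡ-<-pos ½ (QP.+-mono-< R0<1 (QP.<-trans (R-decreasing 0) R0<1)) ⟩
    (1ℚ + 1ℚ) * ½        ≡⟨ solve 0 ((con 1ℚ :+ con 1ℚ) :* con ½ := con 1ℚ) refl ⟩
    1ℚ                   ∎
    where
      open QP.≤-Reasoning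
      R0<1 : R 0 < 1ℚ
      R0<1 = QP.≤-<-trans (QP.≤-reflexive R-zero) a<1

  limit : ℚ
  limit = a * a * ½

  limit-pos : 0ℚ < limit
  limit-pos = half-pos (square-pos (QP.<-≤-trans (R-pos 0) (QP.≤-reflexive R-zero)))

  -- Difference of squares: bₖ₊₁ aₖ₊₁ = (Rₖ² − Rₖ₊₁²)/2, so the weighted
  -- partial sums telescope.
  weighted-partial-sum : ∀ M → partialSum (λ k → b k * as k) M ≡ (a * a - R M * R M) * ½
  weighted-partial-sum ℕ.zero =
    solve 1 (λ x → con 0ℚ := (x :* x :- (x :- con 0ℚ) :* (x :- con 0ℚ)) :* con ½) refl a
  weighted-partial-sum (suc M) = begin
    partialSum (λ k → b k * as k) M + b (suc M) * as (suc M)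
      ≡⟨ cong (_+ b (suc M) * as (suc M)) (weighted-partial-sum M) ⟩
    (a * a - R M * R M) * ½ + b (suc M) * as (suc M)
      ≡⟨ solve 3 (λ x s t →
           (x :* x :- (x :- s) :* (x :- s)) :* con ½
             :+ (((x :- s) :+ (x :- (s :+ t))) :* con ½) :* t
           := (x :* x :- (x :- (s :+ t)) :* (x :- (s :+ t))) :* con ½)
         refl a (S M) (as (suc M)) ⟩
    (a * a - R (suc M) * R (suc M)) * ½
      ∎
    where open ≡-Reasoning

  distance-to-limit : ∀ M → ∣ partialSum (λ k → b k * as k) M - limit ∣ ≡ R M * R M * ½
  distance-to-limit M = begin
    ∣ partialSum (λ k → b k * as k) M - limit ∣
      ≡⟨ cong (λ s → ∣ s - limit ∣) (weighted-partial-sum M) ⟩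
    ∣ (a * a - R M * R M) * ½ - a * a * ½ ∣
      ≡⟨ cong ∣_∣ (solve 2 (λ x r → (x :* x :- r :* r) :* con ½ :- x :* x :* con ½
                                   := :- (r :* r :* con ½)) refl a (R M)) ⟩
    ∣ - (R M * R M * ½) ∣
      ≡⟨ QP.∣-p∣≡∣p∣ (R M * R M * ½) ⟩
    ∣ R M * R M * ½ ∣
      ≡⟨ QP.0≤p⇒∣p∣≡p (QP.<⇒≤ (half-pos (square-pos (R-pos M)))) ⟩
    R M * R M * ½
      ∎
    where open ≡-Reasoning

  -- Since R_M ≤ a < 1, the distance R_M²/2 is at most R_M, which tends to 0.
  weighted-converges : a < 1ℚ → SeriesConvergesTo (λ k → b k * as k) limit
  weighted-converges a<1 ε 0<ε = N , close
    where
      N = proj₁ (R-small ε 0<ε)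
      close : ∀ M → N ≤ M → ∣ partialSum (λ k → b k * as k) M - limit ∣ < ε
      close M N≤M = begin-strict
        ∣ partialSum (λ k → b k * as k) M - limit ∣  ≡⟨ distance-to-limit M ⟩
        R M * R M * ½                                ≤⟨ half-square≤ (R-pos M) (QP.<⇒≤ (QP.≤-<-trans (R≤a M) a<1)) ⟩
        R M                                          <⟨ proj₂ (R-small ε 0<ε) M N≤M ⟩
        ε                                            ∎
        where open QP.≤-Reasoning

lemma3 : (p q : ℕ) (hp : 2 ≤ p) (hq : 2 ≤ q)
    (m n : ℕ → ℕ) (a : ℚ) (as : ℕ → ℚ) →
    (∀ i → 2 ≤ m i) → (∀ i → 2 ≤ n i) →
    0ℚ < a → (∀ k → 1 ≤ k → 0ℚ < as k) →
    (∀ x y x′ y′ → 2 ≤ x → 2 ≤ y → 2 ≤ x′ → 2 ≤ y′ →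
      p ^ x ℕ.* q ^ y ≡ p ^ x′ ℕ.* q ^ y′ → x ≡ x′ × y ≡ y′) →
    (∀ x y → 2 ≤ x → 2 ≤ y → ∃[ i ] (m i ≡ x × n i ≡ y)) →
    (∀ i j → m i ≡ m j → n i ≡ n j → i ≡ j) →
    (∀ i → p ^ m i ℕ.* q ^ n i ℕ.< p ^ m (suc i) ℕ.* q ^ n (suc i)) →
    (∀ i → as (4 ℕ.* i ℕ.+ 1) ≡ invPow hp hq (m i) (n i)) →
    (∀ i → as (4 ℕ.* i ℕ.+ 2) ≡ ((+ (m i)) / 1) * invPow hp hq (m i) (n i)) →
    (∀ i → as (4 ℕ.* i ℕ.+ 3) ≡ ((+ (m i ℕ.* n i)) / 1) * invPow hp hq (m i) (n i)) →
    (∀ i → as (4 ℕ.* i ℕ.+ 4) ≡ ((+ (n i)) / 1) * invPow hp hq (m i) (n i)) →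
    SeriesConvergesTo as a → a < 1ℚ →
    ∃ λ (bs : ℕ → ℚ) → ((∀ k → 1 ≤ k → 0ℚ < bs k) × bs 1 < 1ℚ ×
      (∀ k → 1 ≤ k → bs (suc k) < bs k) ×
      ∃[ b ] (0ℚ < b × SeriesConvergesTo (λ k → bs k * as k) b))
lemma3 _ _ _ _ _ _ a as _ _ _ as-pos _ _ _ _ _ _ _ _ conv a<1 =
  b , b-pos , b-first a<1 , b-decreasing , limit , limit-pos , weighted-converges a<1
  where open Weights as a as-pos conv
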